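{- For any integer $k\geq 1$ there exists a set of seven mutually orthogoval $\mathrm{AG}(2k,\mathbb{F}_4)$, and a set of seven mutually orthogoval $\mathrm{AG}(2k,\mathbb{F}_8)$.
   Context: $\mathrm{AG}(d,K)$ is the $d$-dimensional affine space over the field $K$; $\mathbb{F}_q$ is the finite field with $q$ elements. A pair of spaces, both projective or both affine, of the same dimension and order and on the same point set (two incidence structures on a common point set, each isomorphic to the given space) are orthogoval if each line of one space intersects each line of the other space in at most two points. A set of such spaces is mutually orthogoval if every two distinct members are orthogoval. -}

module Defs where

open import Data.Bool using (Bool; true; false; _xor_; _∧_)
open import Data.Nat using (ℕ)
open import Data.Fin using (Fin)
open import Data.Vec using (Vec; zipWith; replicate)
open import Data.Product using (Σ; ∃; _×_; _,_)
open import Data.Empty using (⊥)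
open import Relation.Binary.PropositionalEquality using (_≡_; _≢_)
open import Function.Bundles using (_↔_; Inverse)

-- F₄ = F₂[ω]/(ω² + ω + 1); element (a , b) stands for a + bω.
record GF4 : Set where
  constructor gf4
  field c0 c1 : Bool

_+₄_ : GF4 → GF4 → GF4
gf4 a b +₄ gf4 c d = gf4 (a xor c) (b xor d)

_*₄_ : GF4 → GF4 → GF4
gf4 a b *₄ gf4 c d = gf4 ((a ∧ c) xor (b ∧ d)) (((a ∧ d) xor (b ∧ c)) xor (b ∧ d))

0₄ : GF4
0₄ = gf4 false false

-- F₈ = F₂[x]/(x³ + x + 1); element (a0 , a1 , a2) stands for a0 + a1 x + a2 x².
record GF8 : Set where
  constructor gf8
  field c0 c1 c2 : Bool

_+₈_ : GF8 → GF8 → GF8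
gf8 a0 a1 a2 +₈ gf8 b0 b1 b2 = gf8 (a0 xor b0) (a1 xor b1) (a2 xor b2)

_*₈_ : GF8 → GF8 → GF8
gf8 a0 a1 a2 *₈ gf8 b0 b1 b2 = gf8 (p0 xor p3) ((p1 xor p3) xor p4) (p2 xor p4)
  where
  p0 = a0 ∧ b0
  p1 = (a0 ∧ b1) xor (a1 ∧ b0)
  p2 = ((a0 ∧ b2) xor (a1 ∧ b1)) xor (a2 ∧ b0)
  p3 = (a1 ∧ b2) xor (a2 ∧ b1)
  p4 = a2 ∧ b2

0₈ : GF8
0₈ = gf8 false false false

module AG (F : Set) (_+_ : F → F → F) (_*_ : F → F → F) (0F : F) (d : ℕ) where

  Point : Set
  Point = Vec F d

  record Line : Set where
    constructor line
    field
      base : Point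
      dir  : Point
      dir≢0 : dir ≢ replicate d 0F

  _∈L_ : Point → Line → Set
  x ∈L line p v _ = ∃ λ (t : F) → x ≡ zipWith (λ a b → a + (t * b)) p v

  -- A copy of AG(d,F) on the point set X: an incidence structure on X
  -- isomorphic to AG(d,F), presented via the point bijection σ : F^d ↔ X.
  -- Its lines are the images σ(ℓ) of the standard lines ℓ.
  module _ {X : Set} (σ : Point ↔ X) where
    OnLine : X → Line → Set
    OnLine x ℓ = Inverse.from σ x ∈L ℓ

  Orthogoval : {X : Set} → (Point ↔ X) → (Point ↔ X) → Set
  Orthogoval {X} σ τ =
    (ℓ ℓ' : Line) (x y z : X) → x ≢ y → x ≢ z → y ≢ z →
    OnLine σ x ℓ → OnLine σ y ℓ → OnLine σ z ℓ →
    OnLine τ x ℓ' → OnLine τ y ℓ' → OnLine τ z ℓ' → ⊥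

  MutuallyOrthogoval : ℕ → Set₁
  MutuallyOrthogoval n =
    Σ Set (λ X → Σ (Fin n → (Point ↔ X)) (λ σ →
      (i j : Fin n) → i ≢ j → Orthogoval (σ i) (σ j)))

{-# OPTIONS --safe #-}
module Submission where

-- Let F = F_q with q = 2^h. For an additive bijection h of F², the images under h⁻¹ of the lines
-- of AG(2, F) form a copy of AG(2, F) on the point set F², and translations are automorphisms
-- of that copy. So three distinct points x, y, z lie on a line of the copy iff h(x + y) and
-- h(x + z) are F-proportional, and the copies of two additive bijections h, h′ are orthogoval
-- as soon as no two distinct nonzero vectors u, w have both h u ∥ h w and h′ u ∥ h′ w. For q = 4
-- and q = 8 there is an F₂-linear g of order 7 such that id and every power gᵐ (0 < m < 7)
-- pass this finite test, which is checked by exhaustive computation; the copies of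
-- g⁰, …, g⁶ are then mutually orthogoval, because the test for gⁱ, gʲ is the one for
-- id, g^(j−i) moved by gⁱ.
--
-- Orthogovality survives products: a line of AG(d₁ + d₂, F) projects to AG(d₁, F) either onto
-- a line, injectively in the parameter, or onto a single point, so three distinct collinear
-- points stay distinct and collinear in one of the two factors. Hence AG(2k, F) = AG(2, F)^k
-- inherits seven mutually orthogoval copies.

open import Defs
open import Algebra.Bundles using (CommutativeSemigroup)
open import Algebra.Core using (Op₂)
import Algebra.Definitions
import Algebra.Properties.CommutativeSemigroup as CommutativeSemigroupProperties
open import Data.Bool using (Bool; true; false; if_then_else_)
open import Data.Bool.Properties using () renaming (_≟_ to _≟ᴮ_)
open import Data.Empty using (⊥; ⊥-elim)
open import Data.Fin using (Fin; toℕ)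
open import Data.Fin.Properties using (toℕ-injective; toℕ≤n; toℕ<n)
import Data.List as List
open import Data.List using (List; []; _∷_; upTo)
open import Data.List.Relation.Unary.Any using (here; there)
import Data.List.Relation.Unary.All as All
open import Data.List.Relation.Unary.Enumerates.Setoid using (IsEnumeration)
open import Data.Nat as ℕ using (ℕ; zero; suc; _+_; _*_; _∸_; _≤_; _<_; _≡ᵇ_; _%_; _/_; _<?_)
import Data.Nat.Properties as ℕ
open import Data.Product using (Σ; _×_; _,_; proj₁; proj₂; uncurry)
open import Data.Product.Function.NonDependent.Propositional using (_×-↔_)
open import Data.Product.Properties using (×-≡,≡→≡)
open import Data.Sum using (_⊎_; inj₁; inj₂)
open import Data.Vec using (Vec; []; _∷_; _++_; take; drop; zipWith; map; replicate)
open import Data.Vec.Properties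
  using (∷-injectiveˡ; ∷-injectiveʳ; ++-injective; take++drop≡id; take-zipWith; drop-zipWith)
  renaming (≡-dec to ≡-decᵛ)
open import Function using (_∘_; id; case_of_; Injective; _↔_; Inverse; mk↔ₛ′)
open import Function.Bundles using (Injection)
open import Function.Construct.Identity using (↔-id)
open import Function.Properties.Inverse using (↔-trans; ↔-sym; Inverse⇒Injection)
open import Level using (0ℓ)
import Relation.Binary.Definitions as Binary
open import Relation.Binary.Definitions using (DecidableEquality; tri<; tri≈; tri>)
open import Relation.Binary.PropositionalEquality
open import Relation.Nullary using (Dec; yes; no)
open import Relation.Nullary.Decidable
  using (map′; from-yes; _×-dec_; _⊎-dec_; _→-dec_; ¬?; True; toWitness)
open import Relation.Unary using (Pred; Decidable)

Distinct : {X : Set} → X → X → X → Set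
Distinct x y z = x ≢ y × x ≢ z × y ≢ z

distinct-proj₂ : {X₁ X₂ : Set} {x y z : X₁ × X₂} → Distinct x y z →
                 proj₁ x ≡ proj₁ y → proj₁ x ≡ proj₁ z → Distinct (proj₂ x) (proj₂ y) (proj₂ z)
distinct-proj₂ (x≢y , x≢z , y≢z) x₁≡y₁ x₁≡z₁ =
  ( (λ x₂≡y₂ → x≢y (×-≡,≡→≡ (x₁≡y₁ , x₂≡y₂)))
  , (λ x₂≡z₂ → x≢z (×-≡,≡→≡ (x₁≡z₁ , x₂≡z₂)))
  , (λ y₂≡z₂ → y≢z (×-≡,≡→≡ (trans (sym x₁≡y₁) x₁≡z₁ , y₂≡z₂))) )

from-injective : {A X : Set} (σ : A ↔ X) → Injective _≡_ _≡_ (Inverse.from σ)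
from-injective σ = Injection.injective (Inverse⇒Injection (↔-sym σ))

++-↔ : {A : Set} {m n : ℕ} → Vec A (m + n) ↔ (Vec A m × Vec A n)
++-↔ {m = m} = mk↔ₛ′ (λ v → take m v , drop m v) (uncurry _++_) take-drop-++ (take++drop≡id m)
  where
  take-drop-++ : ∀ xys → (take m (uncurry _++_ xys) , drop m (uncurry _++_ xys)) ≡ xys
  take-drop-++ (xs , ys) = ×-≡,≡→≡ (++-injective _ xs (take++drop≡id m (xs ++ ys)))

module _ {A : Set} {xs : List A} (enumerates : IsEnumeration (setoid A) xs) where

  all? : {P : Pred A 0ℓ} → Decidable P → Dec (∀ x → P x)
  all? P? = map′ (λ Pxs x → All.lookup Pxs (enumerates x)) (λ ∀P → All.tabulate λ {x} _ → ∀P x)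
                 (All.all? P? xs)

  all-Vec? : ∀ n {P : Pred (Vec A n) 0ℓ} → Decidable P → Dec (∀ v → P v)
  all-Vec? zero    P? = map′ (λ { P[] [] → P[] }) (λ ∀P → ∀P []) (P? [])
  all-Vec? (suc n) P? = map′ (λ { ∀P (x ∷ v) → ∀P x v }) (λ ∀P x v → ∀P (x ∷ v))
                             (all? λ x → all-Vec? n λ v → P? (x ∷ v))

module _ {F : Set} where
  open Algebra.Definitions (_≡_ {A = F})

  record IsChar2Field (_+_ _*_ : Op₂ F) (0# : F) : Set where
    field
      _≟_              : DecidableEquality F
      +-assoc          : Associative _+_
      +-comm           : Commutative _+_
      +-identityʳ      : RightIdentity 0# _+_
      x+x≡0            : ∀ x → x + x ≡ 0#
      *-assoc          : Associative _*_
      *-comm           : Commutative _*_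
      *-distribʳ       : _*_ DistributesOverʳ _+_
      *-zeroʳ          : RightZero 0# _*_
      no-zero-divisors : ∀ x y → x * y ≡ 0# → x ≡ 0# ⊎ y ≡ 0#

  module _ {elements : List F} (enumerates : IsEnumeration (setoid F) elements)
           (_≟_ : DecidableEquality F) (_+_ _*_ : Op₂ F) (0# : F) where

    private
      ∀₁? : {P : F → Set} → (∀ x → Dec (P x)) → Dec (∀ x → P x)
      ∀₁? = all? enumerates

      ∀₂? : {P : F → F → Set} → (∀ x y → Dec (P x y)) → Dec (∀ x y → P x y)
      ∀₂? P? = ∀₁? λ x → ∀₁? (P? x)

      ∀₃? : {P : F → F → F → Set} → (∀ x y z → Dec (P x y z)) → Dec (∀ x y z → P x y z)
      ∀₃? P? = ∀₁? λ x → ∀₂? (P? x)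

    isChar2Field? : Dec (IsChar2Field _+_ _*_ 0#)
    isChar2Field? = map′
      (λ (a , b , c , d , e , f , g , h , i) → record
        { _≟_ = _≟_ ; +-assoc = a ; +-comm = b ; +-identityʳ = c ; x+x≡0 = d
        ; *-assoc = e ; *-comm = f ; *-distribʳ = g ; *-zeroʳ = h ; no-zero-divisors = i })
      (λ r → let open IsChar2Field r in
        +-assoc , +-comm , +-identityʳ , x+x≡0 , *-assoc , *-comm , *-distribʳ , *-zeroʳ , no-zero-divisors)
      ( ∀₃? (λ x y z → ((x + y) + z) ≟ (x + (y + z)))
      ×-dec ∀₂? (λ x y → (x + y) ≟ (y + x))
      ×-dec ∀₁? (λ x → (x + 0#) ≟ x)
      ×-dec ∀₁? (λ x → (x + x) ≟ 0#)
      ×-dec ∀₃? (λ x y z → ((x * y) * z) ≟ (x * (y * z)))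
      ×-dec ∀₂? (λ x y → (x * y) ≟ (y * x))
      ×-dec ∀₃? (λ x y z → ((y + z) * x) ≟ ((y * x) + (z * x)))
      ×-dec ∀₁? (λ x → (x * 0#) ≟ 0#)
      ×-dec ∀₂? (λ x y → ((x * y) ≟ 0#) →-dec ((x ≟ 0#) ⊎-dec (y ≟ 0#))))

module Geometry {F : Set} {_+_ _*_ : Op₂ F} {0# : F} (isChar2Field : IsChar2Field _+_ _*_ 0#) where
  open IsChar2Field isChar2Field
  open Algebra.Definitions (_≡_ {A = F}) using (Associative; Commutative)
  open ≡-Reasoning

  commutativeSemigroup : {_∙_ : Op₂ F} → Associative _∙_ → Commutative _∙_ → CommutativeSemigroup 0ℓ 0ℓ
  commutativeSemigroup {_∙_} assoc comm = record
    { Carrier = F ; _≈_ = _≡_ ; _∙_ = _∙_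
    ; isCommutativeSemigroup = record
      { isSemigroup = record
        { isMagma = record { isEquivalence = isEquivalence ; ∙-cong = cong₂ _∙_ } ; assoc = assoc }
      ; comm = comm } }

  open CommutativeSemigroupProperties (commutativeSemigroup +-assoc +-comm)
    using () renaming (interchange to +-interchange)
  open CommutativeSemigroupProperties (commutativeSemigroup *-assoc *-comm)
    using () renaming (interchange to *-interchange)

  +-identityˡ : ∀ x → (0# + x) ≡ x
  +-identityˡ x = trans (+-comm 0# x) (+-identityʳ x)

  +-cancelˡ : ∀ x {y z} → (x + y) ≡ (x + z) → y ≡ z
  +-cancelˡ x {y} {z} x+y≡x+z = begin
    y              ≡⟨ +-identityˡ y ⟨
    (0# + y)       ≡⟨ cong (_+ y) (x+x≡0 x) ⟨
    ((x + x) + y)  ≡⟨ +-assoc x x y ⟩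
    (x + (x + y))  ≡⟨ cong (x +_) x+y≡x+z ⟩
    (x + (x + z))  ≡⟨ +-assoc x x z ⟨
    ((x + x) + z)  ≡⟨ cong (_+ z) (x+x≡0 x) ⟩
    (0# + z)       ≡⟨ +-identityˡ z ⟩
    z              ∎

  x+y≡0⇒x≡y : ∀ {x y} → (x + y) ≡ 0# → x ≡ y
  x+y≡0⇒x≡y {x} {y} x+y≡0 = +-cancelˡ y (trans (+-comm y x) (trans x+y≡0 (sym (x+x≡0 y))))

  [p+av]+[p+bv]≡[a+b]v : ∀ p v a b → ((p + (a * v)) + (p + (b * v))) ≡ ((a + b) * v)
  [p+av]+[p+bv]≡[a+b]v p v a b = begin
    ((p + (a * v)) + (p + (b * v)))  ≡⟨ +-interchange p (a * v) p (b * v) ⟩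
    ((p + p) + ((a * v) + (b * v)))  ≡⟨ cong (_+ _) (x+x≡0 p) ⟩
    (0# + ((a * v) + (b * v)))       ≡⟨ +-identityˡ _ ⟩
    ((a * v) + (b * v))              ≡⟨ *-distribʳ v a b ⟨
    ((a + b) * v)                    ∎

  p+tv≡p+sv⇒t≡s : ∀ p {v t s} → v ≢ 0# → (p + (t * v)) ≡ (p + (s * v)) → t ≡ s
  p+tv≡p+sv⇒t≡s p {v} {t} {s} v≢0 p+tv≡p+sv with no-zero-divisors (t + s) v (begin
    ((t + s) * v)        ≡⟨ *-distribʳ v t s ⟩
    ((t * v) + (s * v))  ≡⟨ cong (_+ (s * v)) (+-cancelˡ p p+tv≡p+sv) ⟩
    ((s * v) + (s * v))  ≡⟨ x+x≡0 (s * v) ⟩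
    0#                   ∎)
  ... | inj₁ t+s≡0 = x+y≡0⇒x≡y t+s≡0
  ... | inj₂ v≡0   = ⊥-elim (v≢0 v≡0)

  _≟ᵛ_ : ∀ {d} → DecidableEquality (Vec F d)
  _≟ᵛ_ = ≡-decᵛ _≟_

  0⃗ : ∀ {d} → Vec F d
  0⃗ = replicate _ 0#

  _⊕_ : ∀ {d} → Op₂ (Vec F d)
  _⊕_ = zipWith _+_

  _·_ : ∀ {d} → F → Vec F d → Vec F d
  t · v = map (t *_) v

  point : ∀ {d} → Vec F d → Vec F d → F → Vec F d
  point p v t = zipWith (λ a b → a + (t * b)) p v

  point-injective : ∀ {d} {p v : Vec F d} {t s} → v ≢ 0⃗ → point p v t ≡ point p v s → t ≡ s
  point-injective {v = []}            v≢0⃗ _  = ⊥-elim (v≢0⃗ refl)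
  point-injective {p = a ∷ p} {b ∷ v} v≢0⃗ eq with b ≟ 0#
  ... | no b≢0   = p+tv≡p+sv⇒t≡s a b≢0 (∷-injectiveˡ eq)
  ... | yes refl = point-injective (v≢0⃗ ∘ cong (0# ∷_)) (∷-injectiveʳ eq)

  point-0⃗ : ∀ {d} (p : Vec F d) t → point p 0⃗ t ≡ p
  point-0⃗ []      t = refl
  point-0⃗ (a ∷ p) t = cong₂ _∷_ (trans (cong (a +_) (*-zeroʳ t)) (+-identityʳ a)) (point-0⃗ p t)

  point-sum : ∀ {d} (p v : Vec F d) a b → (point p v a ⊕ point p v b) ≡ ((a + b) · v)
  point-sum []      []      a b = refl
  point-sum (c ∷ p) (w ∷ v) a b = cong₂ _∷_ ([p+av]+[p+bv]≡[a+b]v c w a b) (point-sum p v a b)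

  ⊕-cancelˡ : ∀ {d} (x : Vec F d) {y z} → (x ⊕ y) ≡ (x ⊕ z) → y ≡ z
  ⊕-cancelˡ []      {[]}    {[]}    _  = refl
  ⊕-cancelˡ (a ∷ x) {b ∷ y} {c ∷ z} eq =
    cong₂ _∷_ (+-cancelˡ a (∷-injectiveˡ eq)) (⊕-cancelˡ x (∷-injectiveʳ eq))

  x⊕x≡0⃗ : ∀ {d} (x : Vec F d) → (x ⊕ x) ≡ 0⃗
  x⊕x≡0⃗ []      = refl
  x⊕x≡0⃗ (a ∷ x) = cong₂ _∷_ (x+x≡0 a) (x⊕x≡0⃗ x)

  x⊕y≡0⃗⇒x≡y : ∀ {d} {x y : Vec F d} → (x ⊕ y) ≡ 0⃗ → x ≡ y
  x⊕y≡0⃗⇒x≡y {x = []}    {[]}    _  = refl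
  x⊕y≡0⃗⇒x≡y {x = a ∷ x} {b ∷ y} eq =
    cong₂ _∷_ (x+y≡0⇒x≡y (∷-injectiveˡ eq)) (x⊕y≡0⃗⇒x≡y (∷-injectiveʳ eq))

  ++-point : ∀ {m n} {xs : Vec F m} {ys : Vec F n} {p v t} → (xs ++ ys) ≡ point p v t →
             xs ≡ point (take m p) (take m v) t × ys ≡ point (drop m p) (drop m v) t
  ++-point {m} {xs = xs} {ys} {p} {v} {t} eq = ++-injective xs _ (begin
    xs ++ ys                                        ≡⟨ eq ⟩
    point p v t                                     ≡⟨ take++drop≡id m _ ⟨
    take m (point p v t) ++ drop m (point p v t)    ≡⟨ cong₂ _++_ (take-zipWith {m = m} _ p v)
                                                                  (drop-zipWith {m = m} _ p v) ⟩
    point (take m p) (take m v) t ++ point (drop m p) (drop m v) t ∎)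

  open module 𝔸 {d : ℕ} = AG F _+_ _*_ 0# d using (Line; line; OnLine; Orthogoval; MutuallyOrthogoval)

  module _ {d : ℕ} {X : Set} where

    Collinear : (Vec F d ↔ X) → X → X → X → Set
    Collinear σ x y z = Σ Line λ ℓ → OnLine σ x ℓ × OnLine σ y ℓ × OnLine σ z ℓ

    module _ (σ τ : Vec F d ↔ X) where

      orthogoval-intro : (∀ {x y z} → Distinct x y z → Collinear σ x y z → Collinear τ x y z → ⊥) →
                         Orthogoval σ τ
      orthogoval-intro orth ℓ ℓ′ x y z x≢y x≢z y≢z x∈ℓ y∈ℓ z∈ℓ x∈ℓ′ y∈ℓ′ z∈ℓ′ =
        orth (x≢y , x≢z , y≢z) (ℓ , x∈ℓ , y∈ℓ , z∈ℓ) (ℓ′ , x∈ℓ′ , y∈ℓ′ , z∈ℓ′)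

      orthogoval-elim : Orthogoval σ τ →
                        ∀ {x y z} → Distinct x y z → Collinear σ x y z → Collinear τ x y z → ⊥
      orthogoval-elim orth (x≢y , x≢z , y≢z) (ℓ , x∈ℓ , y∈ℓ , z∈ℓ) (ℓ′ , x∈ℓ′ , y∈ℓ′ , z∈ℓ′) =
        orth ℓ ℓ′ _ _ _ x≢y x≢z y≢z x∈ℓ y∈ℓ z∈ℓ x∈ℓ′ y∈ℓ′ z∈ℓ′

    orthogoval-sym : (σ τ : Vec F d ↔ X) → Orthogoval σ τ → Orthogoval τ σ
    orthogoval-sym σ τ orth =
      orthogoval-intro τ σ λ xyz τ-col σ-col → orthogoval-elim σ τ orth xyz σ-col τ-col

    module _ (σ : Vec F d ↔ X) {p v : Vec F d} {x y : X} {a b : F}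
             (x∈ : Inverse.from σ x ≡ point p v a) (y∈ : Inverse.from σ y ≡ point p v b) where

      parameter-≡⇒≡ : a ≡ b → x ≡ y
      parameter-≡⇒≡ refl = from-injective σ (trans x∈ (sym y∈))

      direction-0⃗⇒≡ : v ≡ 0⃗ → x ≡ y
      direction-0⃗⇒≡ refl = from-injective σ (trans x∈ (trans (point-0⃗ p a) (sym (trans y∈ (point-0⃗ p b)))))

      ≡⇒parameter-≡ : v ≢ 0⃗ → x ≡ y → a ≡ b
      ≡⇒parameter-≡ v≢0⃗ refl = point-injective v≢0⃗ (trans (sym x∈) y∈)

  -- Products of copies

  _⊗_ : ∀ {d₁ d₂} {X₁ X₂ : Set} → (Vec F d₁ ↔ X₁) → (Vec F d₂ ↔ X₂) → (Vec F (d₁ ℕ.+ d₂) ↔ (X₁ × X₂))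
  σ₁ ⊗ σ₂ = ↔-trans ++-↔ (σ₁ ×-↔ σ₂)

  module _ {d₁ d₂} {X₁ X₂ : Set} (σ₁ : Vec F d₁ ↔ X₁) (σ₂ : Vec F d₂ ↔ X₂) {p v : Vec F (d₁ ℕ.+ d₂)} where

    module _ {x : X₁ × X₂} {a : F} (x∈ : Inverse.from (σ₁ ⊗ σ₂) x ≡ point p v a) where

      proj₁-∈ : Inverse.from σ₁ (proj₁ x) ≡ point (take d₁ p) (take d₁ v) a
      proj₁-∈ = proj₁ (++-point x∈)

      proj₂-∈ : Inverse.from σ₂ (proj₂ x) ≡ point (drop d₁ p) (drop d₁ v) a
      proj₂-∈ = proj₂ (++-point x∈)

    module _ {x y : X₁ × X₂} {a b : F}
             (x∈ : Inverse.from (σ₁ ⊗ σ₂) x ≡ point p v a) (y∈ : Inverse.from (σ₁ ⊗ σ₂) y ≡ point p v b) where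

      proj₁-≡⇒≡ : take d₁ v ≢ 0⃗ → proj₁ x ≡ proj₁ y → x ≡ y
      proj₁-≡⇒≡ v₁≢0⃗ = parameter-≡⇒≡ (σ₁ ⊗ σ₂) x∈ y∈ ∘ ≡⇒parameter-≡ σ₁ (proj₁-∈ x∈) (proj₁-∈ y∈) v₁≢0⃗

      proj₁-constant : take d₁ v ≡ 0⃗ → proj₁ x ≡ proj₁ y
      proj₁-constant = direction-0⃗⇒≡ σ₁ (proj₁-∈ x∈) (proj₁-∈ y∈)

  module _ {d₁ d₂} {X₁ X₂ : Set} (σ₁ : Vec F d₁ ↔ X₁) (σ₂ : Vec F d₂ ↔ X₂) where

    collinear-⊗ : ∀ {x y z} → Distinct x y z → Collinear (σ₁ ⊗ σ₂) x y z →
      Distinct (proj₁ x) (proj₁ y) (proj₁ z) × Collinear σ₁ (proj₁ x) (proj₁ y) (proj₁ z) ⊎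
      proj₁ x ≡ proj₁ y × Distinct (proj₂ x) (proj₂ y) (proj₂ z) × Collinear σ₂ (proj₂ x) (proj₂ y) (proj₂ z)
    collinear-⊗ {x} {y} {z} xyz@(x≢y , x≢z , y≢z) (line p v _ , (a , x∈) , (b , y∈) , (c , z∈))
      with take d₁ v ≟ᵛ 0⃗
    ... | no v₁≢0⃗ =
      inj₁ ( ( x≢y ∘ proj₁-≡⇒≡ σ₁ σ₂ x∈ y∈ v₁≢0⃗ , x≢z ∘ proj₁-≡⇒≡ σ₁ σ₂ x∈ z∈ v₁≢0⃗
             , y≢z ∘ proj₁-≡⇒≡ σ₁ σ₂ y∈ z∈ v₁≢0⃗ )
           , line (take d₁ p) (take d₁ v) v₁≢0⃗
           , (a , proj₁-∈ σ₁ σ₂ x∈) , (b , proj₁-∈ σ₁ σ₂ y∈) , (c , proj₁-∈ σ₁ σ₂ z∈) )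
    ... | yes v₁≡0⃗ =
      inj₂ ( x₁≡y₁ , xyz₂
           , line (drop d₁ p) (drop d₁ v)
                  (proj₁ xyz₂ ∘ direction-0⃗⇒≡ σ₂ (proj₂-∈ σ₁ σ₂ x∈) (proj₂-∈ σ₁ σ₂ y∈))
           , (a , proj₂-∈ σ₁ σ₂ x∈) , (b , proj₂-∈ σ₁ σ₂ y∈) , (c , proj₂-∈ σ₁ σ₂ z∈) )
      where
      x₁≡y₁ : proj₁ x ≡ proj₁ y
      x₁≡y₁ = proj₁-constant σ₁ σ₂ x∈ y∈ v₁≡0⃗

      xyz₂ : Distinct (proj₂ x) (proj₂ y) (proj₂ z)
      xyz₂ = distinct-proj₂ xyz x₁≡y₁ (proj₁-constant σ₁ σ₂ x∈ z∈ v₁≡0⃗)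

  ⊗-orthogoval : ∀ {d₁ d₂} {X₁ X₂ : Set} (σ₁ τ₁ : Vec F d₁ ↔ X₁) (σ₂ τ₂ : Vec F d₂ ↔ X₂) →
                 Orthogoval σ₁ τ₁ → Orthogoval σ₂ τ₂ → Orthogoval (σ₁ ⊗ σ₂) (τ₁ ⊗ τ₂)
  ⊗-orthogoval σ₁ τ₁ σ₂ τ₂ orth₁ orth₂ = orthogoval-intro (σ₁ ⊗ σ₂) (τ₁ ⊗ τ₂) λ xyz σ-col τ-col →
    case collinear-⊗ σ₁ σ₂ xyz σ-col , collinear-⊗ τ₁ τ₂ xyz τ-col of λ where
      (inj₁ (xyz₁ , σ₁-col) , inj₁ (_ , τ₁-col))        → orthogoval-elim σ₁ τ₁ orth₁ xyz₁ σ₁-col τ₁-col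
      (inj₂ (_ , xyz₂ , σ₂-col) , inj₂ (_ , _ , τ₂-col)) → orthogoval-elim σ₂ τ₂ orth₂ xyz₂ σ₂-col τ₂-col
      (inj₁ ((x₁≢y₁ , _) , _) , inj₂ (x₁≡y₁ , _))       → x₁≢y₁ x₁≡y₁
      (inj₂ (x₁≡y₁ , _) , inj₁ ((x₁≢y₁ , _) , _))       → x₁≢y₁ x₁≡y₁

  mutuallyOrthogoval-0 : ∀ n → MutuallyOrthogoval {0} n
  mutuallyOrthogoval-0 n = Vec F 0 , (λ _ → ↔-id _) , λ _ _ _ → orthogoval-intro (↔-id _) (↔-id _)
    λ { {[]} {[]} (x≢y , _) _ _ → x≢y refl }

  mutuallyOrthogoval-+ : ∀ {d₁ d₂ n} → MutuallyOrthogoval {d₁} n → MutuallyOrthogoval {d₂} n →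
                         MutuallyOrthogoval {d₁ ℕ.+ d₂} n
  mutuallyOrthogoval-+ (X₁ , σ₁ , orth₁) (X₂ , σ₂ , orth₂) =
    (X₁ × X₂) , (λ i → σ₁ i ⊗ σ₂ i) , λ i j i≢j →
      ⊗-orthogoval (σ₁ i) (σ₁ j) (σ₂ i) (σ₂ j) (orth₁ i j i≢j) (orth₂ i j i≢j)

  mutuallyOrthogoval-* : ∀ {d n} → MutuallyOrthogoval {d} n → ∀ k → MutuallyOrthogoval {d ℕ.* k} n
  mutuallyOrthogoval-* {d} {n} orth k = subst (λ d′ → MutuallyOrthogoval {d′} n) (ℕ.*-comm k d) (power k)
    where
    power : ∀ k → MutuallyOrthogoval {k ℕ.* d} n
    power zero    = mutuallyOrthogoval-0 n
    power (suc k) = mutuallyOrthogoval-+ orth (power k)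

  -- Copies of AG(2, F) from additive bijections

  open import Function.Endo.Propositional (Vec F 2) using (_^_; ^-homo)

  Parallel : Vec F 2 → Vec F 2 → Set
  Parallel (a ∷ b ∷ []) (c ∷ d ∷ []) = (a * d) ≡ (b * c)

  parallel? : Binary.Decidable Parallel
  parallel? (a ∷ b ∷ []) (c ∷ d ∷ []) = (a * d) ≟ (b * c)

  ·-parallel : ∀ a b v → Parallel (a · v) (b · v)
  ·-parallel a b (v₁ ∷ v₂ ∷ []) = begin
    ((a * v₁) * (b * v₂))  ≡⟨ *-interchange a v₁ b v₂ ⟩
    ((a * b) * (v₁ * v₂))  ≡⟨ cong ((a * b) *_) (*-comm v₁ v₂) ⟩
    ((a * b) * (v₂ * v₁))  ≡⟨ *-interchange a v₂ b v₁ ⟨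
    ((a * v₂) * (b * v₁))  ∎

  Additive : ∀ {d} → (Vec F d → Vec F d) → Set
  Additive h = ∀ u w → h (u ⊕ w) ≡ (h u ⊕ h w)

  additive⇒0⃗ : ∀ {d} {h : Vec F d → Vec F d} → Additive h → h 0⃗ ≡ 0⃗
  additive⇒0⃗ {h = h} h-additive = begin
    h 0⃗          ≡⟨ cong h (x⊕x≡0⃗ 0⃗) ⟨
    h (0⃗ ⊕ 0⃗)    ≡⟨ h-additive 0⃗ 0⃗ ⟩
    (h 0⃗ ⊕ h 0⃗)  ≡⟨ x⊕x≡0⃗ (h 0⃗) ⟩
    0⃗            ∎

  -- For additive h, the lines through 0⃗ of the copy with from = h are the h-preimages of the
  -- F-lines through 0⃗; this says such lines of the two copies share at most one nonzero point.
  OrthogovalSpreads : (h h′ : Vec F 2 → Vec F 2) → Set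
  OrthogovalSpreads h h′ =
    ∀ u w → u ≢ 0⃗ → w ≢ 0⃗ → u ≢ w → Parallel (h u) (h w) → Parallel (h′ u) (h′ w) → ⊥

  orthogovalSpreads-∘ : ∀ {h h′ k} → Additive k → Injective _≡_ _≡_ k →
                        OrthogovalSpreads h h′ → OrthogovalSpreads (h ∘ k) (h′ ∘ k)
  orthogovalSpreads-∘ {k = k} k-additive k-injective spreads u w u≢0⃗ w≢0⃗ u≢w =
    spreads (k u) (k w) (u≢0⃗ ∘ k≡0⃗⇒≡0⃗) (w≢0⃗ ∘ k≡0⃗⇒≡0⃗) (u≢w ∘ k-injective)
    where
    k≡0⃗⇒≡0⃗ : ∀ {u} → k u ≡ 0⃗ → u ≡ 0⃗
    k≡0⃗⇒≡0⃗ ku≡0⃗ = k-injective (trans ku≡0⃗ (sym (additive⇒0⃗ k-additive)))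

  collinear⇒parallel : ∀ {h} → Additive h → ∀ {x y z p v a b c} →
    h x ≡ point p v a → h y ≡ point p v b → h z ≡ point p v c → Parallel (h (x ⊕ y)) (h (x ⊕ z))
  collinear⇒parallel {h} h-additive {x} {p = p} {v} {a} {b} {c} x∈ y∈ z∈ =
    subst₂ Parallel (sym (h[x⊕y]≡[a+b]v y∈)) (sym (h[x⊕y]≡[a+b]v z∈)) (·-parallel (a + b) (a + c) v)
    where
    h[x⊕y]≡[a+b]v : ∀ {y b} → h y ≡ point p v b → h (x ⊕ y) ≡ ((a + b) · v)
    h[x⊕y]≡[a+b]v {y} {b} y∈ = begin
      h (x ⊕ y)                    ≡⟨ h-additive x y ⟩
      (h x ⊕ h y)                  ≡⟨ cong₂ _⊕_ x∈ y∈ ⟩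
      (point p v a ⊕ point p v b)  ≡⟨ point-sum p v a b ⟩
      ((a + b) · v)                ∎

  orthogovalSpreads⇒orthogoval : (σ τ : Vec F 2 ↔ Vec F 2) →
    Additive (Inverse.from σ) → Additive (Inverse.from τ) →
    OrthogovalSpreads (Inverse.from σ) (Inverse.from τ) → Orthogoval σ τ
  orthogovalSpreads⇒orthogoval σ τ σ-additive τ-additive spreads = orthogoval-intro σ τ λ
    { {x} (x≢y , x≢z , y≢z) (_ , (_ , x∈) , (_ , y∈) , (_ , z∈)) (_ , (_ , x∈′) , (_ , y∈′) , (_ , z∈′)) →
      spreads (x ⊕ _) (x ⊕ _) (x≢y ∘ x⊕y≡0⃗⇒x≡y) (x≢z ∘ x⊕y≡0⃗⇒x≡y) (y≢z ∘ ⊕-cancelˡ x)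
        (collinear⇒parallel σ-additive x∈ y∈ z∈) (collinear⇒parallel τ-additive x∈′ y∈′ z∈′) }

  module Cyclic (g : Vec F 2 → Vec F 2) (g-additive : Additive g) (n : ℕ) (g^n≗id : ∀ u → (g ^ n) u ≡ u)
                (spreads : ∀ {m} → m < n → 0 < m → OrthogovalSpreads id (g ^ m)) where

    ^-additive : ∀ m → Additive (g ^ m)
    ^-additive zero    u w = refl
    ^-additive (suc m) u w = trans (cong g (^-additive m u w)) (g-additive _ _)

    ^-inverse : ∀ {i j} → i ℕ.+ j ≡ n → ∀ u → (g ^ i) ((g ^ j) u) ≡ u
    ^-inverse {i} {j} i+j≡n u = begin
      (g ^ i) ((g ^ j) u)  ≡⟨ cong (λ f → f u) (^-homo g i j) ⟨
      (g ^ (i ℕ.+ j)) u    ≡⟨ cong (λ k → (g ^ k) u) i+j≡n ⟩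
      (g ^ n) u            ≡⟨ g^n≗id u ⟩
      u                    ∎

    copy : Fin n → Vec F 2 ↔ Vec F 2
    copy i = mk↔ₛ′ (g ^ (n ∸ toℕ i)) (g ^ toℕ i)
      (^-inverse {n ∸ toℕ i} (ℕ.m∸n+n≡m (toℕ≤n i))) (^-inverse {toℕ i} (ℕ.m+[n∸m]≡n (toℕ≤n i)))

    copies-orthogoval : ∀ {i j} → toℕ i < toℕ j → Orthogoval (copy i) (copy j)
    copies-orthogoval {i} {j} i<j =
      orthogovalSpreads⇒orthogoval (copy i) (copy j) (^-additive (toℕ i)) (^-additive (toℕ j))
        (subst (OrthogovalSpreads (g ^ toℕ i)) g^[j∸i]∘g^i≡g^j
          (orthogovalSpreads-∘ (^-additive (toℕ i)) (from-injective (copy i))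
            (spreads (ℕ.≤-<-trans (ℕ.m∸n≤m (toℕ j) (toℕ i)) (toℕ<n j)) (ℕ.m<n⇒0<n∸m i<j))))
      where
      g^[j∸i]∘g^i≡g^j : (g ^ (toℕ j ∸ toℕ i)) ∘ (g ^ toℕ i) ≡ g ^ toℕ j
      g^[j∸i]∘g^i≡g^j = trans (sym (^-homo g (toℕ j ∸ toℕ i) (toℕ i))) (cong (g ^_) (ℕ.m∸n+n≡m (ℕ.<⇒≤ i<j)))

    mutuallyOrthogoval : MutuallyOrthogoval {2} n
    mutuallyOrthogoval = Vec F 2 , copy , orthogoval-copies
      where
      orthogoval-copies : ∀ i j → i ≢ j → Orthogoval (copy i) (copy j)
      orthogoval-copies i j i≢j with ℕ.<-cmp (toℕ i) (toℕ j)
      ... | tri< i<j _ _ = copies-orthogoval i<j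
      ... | tri≈ _ i≡j _ = ⊥-elim (i≢j (toℕ-injective i≡j))
      ... | tri> _ _ j<i = orthogoval-sym (copy j) (copy i) (copies-orthogoval j<i)

  combination : ∀ {m d} → Vec (Vec F d) m → Vec Bool m → Vec F d
  combination []       []       = 0⃗
  combination (c ∷ cs) (b ∷ bs) = (if b then c else 0⃗) ⊕ combination cs bs

  module _ {elements : List F} (enumerates : IsEnumeration (setoid F) elements) where

    additive? : ∀ {d} (h : Vec F d → Vec F d) → Dec (Additive h)
    additive? h = all-Vec? enumerates _ λ u → all-Vec? enumerates _ λ w → h (u ⊕ w) ≟ᵛ (h u ⊕ h w)

    ≗id? : ∀ {d} (h : Vec F d → Vec F d) → Dec (∀ u → h u ≡ u)
    ≗id? h = all-Vec? enumerates _ λ u → h u ≟ᵛ u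

    orthogovalSpreads? : ∀ h h′ → Dec (OrthogovalSpreads h h′)
    orthogovalSpreads? h h′ = all-Vec? enumerates 2 λ u → all-Vec? enumerates 2 λ w →
      ¬? (u ≟ᵛ 0⃗) →-dec ¬? (w ≟ᵛ 0⃗) →-dec ¬? (u ≟ᵛ w) →-dec
      parallel? (h u) (h w) →-dec ¬? (parallel? (h′ u) (h′ w))

    cyclic-mutuallyOrthogoval : ∀ g n → {True (additive? g)} → {True (≗id? (g ^ n))} →
      {True (ℕ.allUpTo? (λ m → 0 <? m →-dec orthogovalSpreads? id (g ^ m)) n)} → MutuallyOrthogoval {2} n
    cyclic-mutuallyOrthogoval g n {g-additive} {g^n≗id} {spreads} =
      Cyclic.mutuallyOrthogoval g (toWitness g-additive) n (toWitness g^n≗id) (toWitness spreads)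

fromℕ₄ : ℕ → GF4
fromℕ₄ n = gf4 (n % 2 ≡ᵇ 1) (n / 2 % 2 ≡ᵇ 1)

fromℕ₈ : ℕ → GF8
fromℕ₈ n = gf8 (n % 2 ≡ᵇ 1) (n / 2 % 2 ≡ᵇ 1) (n / 4 % 2 ≡ᵇ 1)

_≟₄_ : DecidableEquality GF4
gf4 a₀ a₁ ≟₄ gf4 b₀ b₁ =
  map′ (λ { (refl , refl) → refl }) (λ { refl → refl , refl }) ((a₀ ≟ᴮ b₀) ×-dec (a₁ ≟ᴮ b₁))

_≟₈_ : DecidableEquality GF8
gf8 a₀ a₁ a₂ ≟₈ gf8 b₀ b₁ b₂ = map′ (λ { (refl , refl , refl) → refl }) (λ { refl → refl , refl , refl })
  ((a₀ ≟ᴮ b₀) ×-dec (a₁ ≟ᴮ b₁) ×-dec (a₂ ≟ᴮ b₂))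

GF4-elements : List GF4
GF4-elements = List.map fromℕ₄ (upTo 4)

GF4-enumerates : IsEnumeration (setoid GF4) GF4-elements
GF4-enumerates (gf4 false false) = here refl
GF4-enumerates (gf4 true  false) = there (here refl)
GF4-enumerates (gf4 false true)  = there (there (here refl))
GF4-enumerates (gf4 true  true)  = there (there (there (here refl)))

GF8-elements : List GF8
GF8-elements = List.map fromℕ₈ (upTo 8)

GF8-enumerates : IsEnumeration (setoid GF8) GF8-elements
GF8-enumerates (gf8 false false false) = here refl
GF8-enumerates (gf8 true  false false) = there (here refl)
GF8-enumerates (gf8 false true  false) = there (there (here refl))
GF8-enumerates (gf8 true  true  false) = there (there (there (here refl)))
GF8-enumerates (gf8 false false true)  = there (there (there (there (here refl))))
GF8-enumerates (gf8 true  false true)  = there (there (there (there (there (here refl)))))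
GF8-enumerates (gf8 false true  true)  = there (there (there (there (there (there (here refl))))))
GF8-enumerates (gf8 true  true  true)  = there (there (there (there (there (there (there (here refl)))))))

GF4-isChar2Field : IsChar2Field _+₄_ _*₄_ 0₄
GF4-isChar2Field = from-yes (isChar2Field? GF4-enumerates _≟₄_ _+₄_ _*₄_ 0₄)

GF8-isChar2Field : IsChar2Field _+₈_ _*₈_ 0₈
GF8-isChar2Field = from-yes (isChar2Field? GF8-enumerates _≟₈_ _+₈_ _*₈_ 0₈)

module 𝔽₄ = Geometry GF4-isChar2Field
module 𝔽₈ = Geometry GF8-isChar2Field

-- The F₂-linear maps sending the F₂-basis (1,0), (ω,0), (0,1), (0,ω) of F₄², resp.
-- (1,0), (x,0), (x²,0), (0,1), (0,x), (0,x²) of F₈², to the listed vectors.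
g₄ : Vec GF4 2 → Vec GF4 2
g₄ (gf4 a₀ a₁ ∷ gf4 b₀ b₁ ∷ []) = 𝔽₄.combination
  (map (map fromℕ₄) ((3 ∷ 1 ∷ []) ∷ (2 ∷ 0 ∷ []) ∷ (0 ∷ 2 ∷ []) ∷ (3 ∷ 2 ∷ []) ∷ []))
  (a₀ ∷ a₁ ∷ b₀ ∷ b₁ ∷ [])

g₈ : Vec GF8 2 → Vec GF8 2
g₈ (gf8 a₀ a₁ a₂ ∷ gf8 b₀ b₁ b₂ ∷ []) = 𝔽₈.combination
  (map (map fromℕ₈) ( (4 ∷ 0 ∷ []) ∷ (6 ∷ 6 ∷ []) ∷ (5 ∷ 7 ∷ [])
                     ∷ (6 ∷ 5 ∷ []) ∷ (6 ∷ 3 ∷ []) ∷ (4 ∷ 1 ∷ []) ∷ []))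
  (a₀ ∷ a₁ ∷ a₂ ∷ b₀ ∷ b₁ ∷ b₂ ∷ [])

GF4-plane : AG.MutuallyOrthogoval GF4 _+₄_ _*₄_ 0₄ 2 7
GF4-plane = 𝔽₄.cyclic-mutuallyOrthogoval GF4-enumerates g₄ 7

GF8-plane : AG.MutuallyOrthogoval GF8 _+₈_ _*₈_ 0₈ 2 7
GF8-plane = 𝔽₈.cyclic-mutuallyOrthogoval GF8-enumerates g₈ 7

mainTheorem6 : (k : ℕ) → 1 ≤ k →
    AG.MutuallyOrthogoval GF4 _+₄_ _*₄_ 0₄ (2 * k) 7 ×
    AG.MutuallyOrthogoval GF8 _+₈_ _*₈_ 0₈ (2 * k) 7
mainTheorem6 k _ = 𝔽₄.mutuallyOrthogoval-* GF4-plane k , 𝔽₈.mutuallyOrthogoval-* GF8-plane k
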